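{- Let $k\ge 4$ be an integer. For every integer $n\ge k+3$ there exists a $k$-critical graph on $n$ vertices with at most $(k-2)n$ edges.
   Context: All graphs are finite and simple. A vertex or edge of a graph $G$ is called critical if removing it from $G$ produces a graph with smaller chromatic number. A graph $G$ with $\chi(G)=k$ is $k$-critical if every vertex and every edge of $G$ is critical. -}

module Defs where

open import Data.Nat using (ℕ; zero; suc; _+_; _<_)
open import Data.Bool using (Bool; true; false; _∧_; not; if_then_else_)
open import Data.Fin using (Fin; toℕ; punchIn; _≟_)
open import Data.List using (List; length; filterᵇ; allFin; concatMap; map)
open import Data.Product using (Σ; _×_; _,_; ∃; proj₁)
open import Relation.Binary.PropositionalEquality using (_≡_; _≢_)
open import Relation.Nullary using (¬_; does)
open import Data.Nat using (_<ᵇ_)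

record Graph (n : ℕ) : Set where
  field
    adj   : Fin n → Fin n → Bool
    sym   : ∀ u v → adj u v ≡ adj v u
    irrefl : ∀ v → adj v v ≡ false
open Graph public

Adjacent : ∀ {n} → Graph n → Fin n → Fin n → Set
Adjacent G u v = adj G u v ≡ true

IsColouring : ∀ {n} → Graph n → (m : ℕ) → (Fin n → Fin m) → Set
IsColouring G m c = ∀ u v → Adjacent G u v → c u ≢ c v

Colourable : ∀ {n} → Graph n → ℕ → Set
Colourable {n} G m = Σ (Fin n → Fin m) (IsColouring G m)

ChromaticNumber : ∀ {n} → Graph n → ℕ → Set
ChromaticNumber G m = Colourable G m × (∀ j → j < m → ¬ Colourable G j)

pairs : (n : ℕ) → List (Fin n × Fin n)
pairs n = concatMap (λ u → map (λ v → (u , v)) (allFin n)) (allFin n)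

edgeCount : ∀ {n} → Graph n → ℕ
edgeCount {n} G =
  length (filterᵇ (λ p → (toℕ (Data.Product.proj₁ p) <ᵇ toℕ (Data.Product.proj₂ p)) ∧ adj G (Data.Product.proj₁ p) (Data.Product.proj₂ p)) (pairs n))

deleteVertex : ∀ {n} → Graph (suc n) → Fin (suc n) → Graph n
deleteVertex G v = record
  { adj = λ a b → adj G (punchIn v a) (punchIn v b)
  ; sym = λ a b → sym G (punchIn v a) (punchIn v b)
  ; irrefl = λ a → irrefl G (punchIn v a) }

isEdgeUV : ∀ {n} → Fin n → Fin n → Fin n → Fin n → Bool
isEdgeUV u v a b =
  (does (a ≟ u) ∧ does (b ≟ v)) Data.Bool.∨ (does (a ≟ v) ∧ does (b ≟ u))

deleteEdge : ∀ {n} → Graph n → Fin n → Fin n → Graph n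
deleteEdge {n} G u v = record
  { adj = λ a b → adj G a b ∧ not (isEdgeUV u v a b)
  ; sym = symP
  ; irrefl = λ a → irr a }
  where
  open import Data.Bool.Properties using (∧-comm; ∨-comm)
  open import Relation.Binary.PropositionalEquality using (cong₂; refl)
  symP : ∀ a b → (adj G a b ∧ not (isEdgeUV u v a b)) ≡ (adj G b a ∧ not (isEdgeUV u v b a))
  symP a b = cong₂ (λ x y → x ∧ not y) (sym G a b)
               (Relation.Binary.PropositionalEquality.trans (∨-comm (does (a ≟ u) ∧ does (b ≟ v)) (does (a ≟ v) ∧ does (b ≟ u))) refl')
    where
    refl' : ((does (a ≟ v) ∧ does (b ≟ u)) Data.Bool.∨ (does (a ≟ u) ∧ does (b ≟ v)))
            ≡ isEdgeUV u v b a
    refl' = cong₂ Data.Bool._∨_ (∧-comm (does (a ≟ v)) (does (b ≟ u))) (∧-comm (does (a ≟ u)) (does (b ≟ v)))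
  irr : ∀ a → (adj G a a ∧ not (isEdgeUV u v a a)) ≡ false
  irr a rewrite irrefl G a = refl

CriticalVertex : ∀ {n} → Graph n → Fin n → Set
CriticalVertex {suc n} G v = ∀ a b → ChromaticNumber G a → ChromaticNumber (deleteVertex G v) b → b < a

CriticalEdge : ∀ {n} → Graph n → Fin n → Fin n → Set
CriticalEdge G u v = ∀ a b → ChromaticNumber G a → ChromaticNumber (deleteEdge G u v) b → b < a

KCritical : ∀ {n} → ℕ → Graph n → Set
KCritical k G =
  ChromaticNumber G k
  × (∀ v → CriticalVertex G v)
  × (∀ u v → Adjacent G u v → CriticalEdge G u v)

-- Criticality is handled in a stronger form: G is not (k-1)-colourable, deleting any edge makes
-- it (k-1)-colourable, and G has no isolated vertex. Two constructions preserve this. The cone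
-- (a new vertex joined to all n old ones) raises k by one and adds n edges, so i cones turn a
-- 4-critical graph with at most 2n edges into a (4+i)-critical graph on n+i vertices with at most
-- (2+i)(n+i) edges. The Hajós join with K_k keeps k and adds k-1 vertices and at most k(k-1)/2
-- edges; for k = 4 these are 3 vertices and 6 edges, so the bound of 2n edges survives. Starting
-- from K₄ and the wheels over C₅ and C₇ (4, 6 and 8 vertices), Hajós joins with K₄ thus give
-- 4-critical graphs with at most 2n edges on every n ≥ 7; the odd cycles themselves come from K₃
-- by Hajós joins with K₃.

module Submission where

open import Data.Bool using (Bool; true; false; not; _∧_; if_then_else_)
open import Data.Empty using (⊥-elim)
open import Data.Fin using (Fin; zero; suc; toℕ; splitAt; fromℕ; inject₁; inject≤; punchIn; punchOut; _↑ʳ_)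
open import Data.Fin.Permutation.Components using (transpose; transpose-inverse)
open import Data.Fin.Properties
  using ( _≟_; fromℕ≢inject₁; inject₁-injective; inject≤-injective; punchInᵢ≢i; punchIn-injective
        ; punchOut-injective; pigeonhole; <⇒≢; +↔⊎)
open import Data.List using (List; []; _∷_; _++_; length; filterᵇ; tabulate; concatMap; map; allFin)
open import Data.List.Properties using (length-++; filter-++; tabulate-cong; map-tabulate)
open import Data.Nat using (ℕ; zero; suc; _+_; _*_; _∸_; _≤_; _<_; _≤?_; _<?_; _<ᵇ_; z≤n; s≤s; s≤s⁻¹)
open import Data.Nat.Combinatorics using (_C_; nC1≡n; nCk+nC[k+1]≡[n+1]C[k+1])
open import Data.Nat.ListAction using (sum)
open import Data.Nat.Properties
  using ( m≤n⇒m≤1+n; n≤1+n; +-mono-≤; +-monoʳ-≤; *-monoʳ-≤; *-identityˡ; *-identityʳ; *-distribˡ-+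
        ; ≤-refl; ≤-reflexive; ≰⇒>; ≮⇒≥; ≤⇒≯; ≤-<-trans; m≤n⇒∃[o]m+o≡n; module ≤-Reasoning)
open import Data.Nat.Solver using (module +-*-Solver)
open import Data.Product using (Σ; ∃; _×_; _,_; proj₁; proj₂)
import Data.Product as Product
open import Data.Sum using (_⊎_; inj₁; inj₂; map₁; [_,_])
import Data.Sum as Sum
open import Function using (_∘_; id; _↔_; Inverse; case_of_)
open import Relation.Binary.PropositionalEquality
  using (_≡_; _≢_; refl; sym; trans; cong; subst; subst₂; module ≡-Reasoning)
open import Relation.Nullary using (¬_; Dec; yes; no; does; contradiction)
open import Relation.Nullary.Decidable using (T?; _×-dec_; _⊎-dec_; dec-true; dec-false; toWitness)

open import Defs hiding (sym)

-- Counting vertices and edges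

count : ∀ {n} → (Fin n → Bool) → ℕ
count {zero}  p = 0
count {suc n} p = if p zero then suc (count (p ∘ suc)) else count (p ∘ suc)

count-mono : ∀ {n} {p q : Fin n → Bool} → (∀ v → p v ≡ true → q v ≡ true) → count p ≤ count q
count-mono {zero}          p⇒q = z≤n
count-mono {suc n} {p} {q} p⇒q with p zero in p₀ | q zero in q₀
... | true  | true  = s≤s (count-mono (p⇒q ∘ suc))
... | true  | false with () ← trans (sym (p⇒q zero p₀)) q₀
... | false | true  = m≤n⇒m≤1+n (count-mono (p⇒q ∘ suc))
... | false | false = count-mono (p⇒q ∘ suc)

count≤n : ∀ {n} (p : Fin n → Bool) → count p ≤ n
count≤n {zero}  p = z≤n
count≤n {suc n} p with p zero
... | true  = s≤s (count≤n (p ∘ suc))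
... | false = m≤n⇒m≤1+n (count≤n (p ∘ suc))

count-true : ∀ n → count {n} (λ _ → true) ≡ n
count-true zero    = refl
count-true (suc n) = cong suc (count-true n)

count-false : ∀ n → count {n} (λ _ → false) ≡ 0
count-false zero    = refl
count-false (suc n) = count-false n

count-≟ : ∀ {n} (y : Fin n) → count (λ v → does (v ≟ y)) ≡ 1
count-≟ {suc n} zero    = cong suc (count-false n)
count-≟ {suc n} (suc y) = count-≟ y

count-splitAt : ∀ k {p} (f : Fin k ⊎ Fin p → Bool) →
                count (f ∘ splitAt k) ≡ count (f ∘ inj₁) + count (f ∘ inj₂)
count-splitAt zero    f = refl
count-splitAt (suc k) f with f (inj₁ zero)
... | true  = cong suc (count-splitAt k (f ∘ map₁ suc))
... | false = count-splitAt k (f ∘ map₁ suc)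

length-filterᵇ-tabulate : ∀ {A : Set} {n} (p : A → Bool) (f : Fin n → A) →
                          length (filterᵇ p (tabulate f)) ≡ count (p ∘ f)
length-filterᵇ-tabulate {n = zero}  p f = refl
length-filterᵇ-tabulate {n = suc n} p f with p (f zero)
... | true  = cong suc (length-filterᵇ-tabulate p (f ∘ suc))
... | false = length-filterᵇ-tabulate p (f ∘ suc)

length-filterᵇ-concatMap : ∀ {A B : Set} (p : B → Bool) (g : A → List B) xs →
  length (filterᵇ p (concatMap g xs)) ≡ sum (map (λ x → length (filterᵇ p (g x))) xs)
length-filterᵇ-concatMap p g []       = refl
length-filterᵇ-concatMap p g (x ∷ xs) = begin
  length (filterᵇ p (g x ++ concatMap g xs))
    ≡⟨ cong length (filter-++ (T? ∘ p) (g x) (concatMap g xs)) ⟩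
  length (filterᵇ p (g x) ++ filterᵇ p (concatMap g xs))
    ≡⟨ length-++ (filterᵇ p (g x)) ⟩
  length (filterᵇ p (g x)) + length (filterᵇ p (concatMap g xs))
    ≡⟨ cong (length (filterᵇ p (g x)) +_) (length-filterᵇ-concatMap p g xs) ⟩
  length (filterᵇ p (g x)) + sum (map (λ x → length (filterᵇ p (g x))) xs) ∎
  where open ≡-Reasoning

forwardDegree : ∀ {n} → Graph n → Fin n → ℕ
forwardDegree G u = count (λ v → (toℕ u <ᵇ toℕ v) ∧ adj G u v)

edgeCount≡sum-forwardDegree : ∀ {n} (G : Graph n) → edgeCount G ≡ sum (tabulate (forwardDegree G))
edgeCount≡sum-forwardDegree {n} G = begin
  edgeCount G
    ≡⟨ length-filterᵇ-concatMap isForwardEdge row (allFin n) ⟩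
  sum (map (length ∘ filterᵇ isForwardEdge ∘ row) (allFin n))
    ≡⟨ cong sum (map-tabulate id (length ∘ filterᵇ isForwardEdge ∘ row)) ⟩
  sum (tabulate (length ∘ filterᵇ isForwardEdge ∘ row))
    ≡⟨ cong sum (tabulate-cong λ u → trans (cong (length ∘ filterᵇ isForwardEdge) (map-tabulate id (u ,_)))
                                            (length-filterᵇ-tabulate isForwardEdge (u ,_))) ⟩
  sum (tabulate (forwardDegree G)) ∎
  where
  open ≡-Reasoning
  isForwardEdge : Fin n × Fin n → Bool
  isForwardEdge (u , v) = (toℕ u <ᵇ toℕ v) ∧ adj G u v
  row : Fin n → List (Fin n × Fin n)
  row u = map (u ,_) (allFin n)

-- The forward degrees of zero and of suc u in G are, by computation, the degree of zero
-- and the forward degree of u in G - zero.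
edgeCount-suc : ∀ {n} (G : Graph (suc n)) →
                edgeCount G ≡ count (adj G zero ∘ suc) + edgeCount (deleteVertex G zero)
edgeCount-suc G = trans (edgeCount≡sum-forwardDegree G)
  (cong (count (adj G zero ∘ suc) +_) (sym (edgeCount≡sum-forwardDegree (deleteVertex G zero))))

edgeCount-mono : ∀ {n} {G H : Graph n} → (∀ a b → Adjacent G a b → Adjacent H a b) →
                 edgeCount G ≤ edgeCount H
edgeCount-mono {zero}          G⇒H = z≤n
edgeCount-mono {suc n} {G} {H} G⇒H rewrite edgeCount-suc G | edgeCount-suc H =
  +-mono-≤ (count-mono (G⇒H zero ∘ suc))
           (edgeCount-mono {G = deleteVertex G zero} {deleteVertex H zero} λ a b → G⇒H (suc a) (suc b))

-- Colourings and criticality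

SameEdge : {V : Set} → V → V → V → V → Set
SameEdge u v a b = (a ≡ u × b ≡ v) ⊎ (a ≡ v × b ≡ u)

sameEdge-swap : ∀ {V : Set} {u v a b : V} → SameEdge u v a b → SameEdge v u a b
sameEdge-swap = Sum.swap

sameEdge-flip : ∀ {V : Set} {u v a b : V} → SameEdge u v a b → SameEdge u v b a
sameEdge-flip (inj₁ (a≡u , b≡v)) = inj₂ (b≡v , a≡u)
sameEdge-flip (inj₂ (a≡v , b≡u)) = inj₁ (b≡u , a≡v)

sameEdge-comm : ∀ {V : Set} {u v a b : V} → SameEdge u v a b → SameEdge a b u v
sameEdge-comm (inj₁ (refl , refl)) = inj₁ (refl , refl)
sameEdge-comm (inj₂ (refl , refl)) = inj₂ (refl , refl)

sameEdge-map : ∀ {V W : Set} (f : V → W) {u v a b} → SameEdge u v a b → SameEdge (f u) (f v) (f a) (f b)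
sameEdge-map f = Sum.map (Product.map (cong f) (cong f)) (Product.map (cong f) (cong f))

sameEdge-injective : ∀ {V W : Set} {f : V → W} → (∀ {a b} → f a ≡ f b → a ≡ b) →
                     ∀ {u v a b} → SameEdge (f u) (f v) (f a) (f b) → SameEdge u v a b
sameEdge-injective f-inj = Sum.map (Product.map f-inj f-inj) (Product.map f-inj f-inj)

sameEdge? : ∀ {n} (u v a b : Fin n) → Dec (SameEdge u v a b)
sameEdge? u v a b = (a ≟ u ×-dec b ≟ v) ⊎-dec (a ≟ v ×-dec b ≟ u)

module _ {V : Set} (A : V → V → Bool) {m : ℕ} where

  IsProper : (V → Fin m) → Set
  IsProper c = ∀ a b → A a b ≡ true → c a ≢ c b

  IsProperExcept : (V → Fin m) → V → V → Set
  IsProperExcept c u v = ∀ a b → A a b ≡ true → c a ≡ c b → SameEdge u v a b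

isProperExcept-swap : ∀ {V : Set} {A : V → V → Bool} {m} {c : V → Fin m} {u v} →
                      IsProperExcept A c u v → IsProperExcept A c v u
isProperExcept-swap c-except a b e eq = sameEdge-swap (c-except a b e eq)

-- m is the number of colours, one less than the chromatic number.
record EdgeCritical (m : ℕ) {V : Set} (A : V → V → Bool) : Set where
  field
    notColourable     : (c : V → Fin m) → ¬ IsProper A c
    colourableWithout : ∀ u v → A u v ≡ true → Σ (V → Fin m) λ c → IsProperExcept A c u v
    neighbour         : ∀ v → ∃ λ w → A v w ≡ true
open EdgeCritical public

isProperExcept⇒≡ : ∀ {V : Set} {A : V → V → Bool} {m} → EdgeCritical m A →
                   ∀ {c u v} → IsProperExcept A c u v → c u ≡ c v
isProperExcept⇒≡ cr {c} {u} {v} c-except with c u ≟ c v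
... | yes cu≡cv = cu≡cv
... | no  cu≢cv = ⊥-elim (notColourable cr c c-proper)
  where
  c-proper : IsProper _ c
  c-proper a b e ca≡cb with c-except a b e ca≡cb
  ... | inj₁ (refl , refl) = cu≢cv ca≡cb
  ... | inj₂ (refl , refl) = cu≢cv (sym ca≡cb)

relabel : ∀ {W V : Set} {m} {A : V → V → Bool} (σ : W ↔ V) →
          EdgeCritical m A → EdgeCritical m (λ a b → A (Inverse.to σ a) (Inverse.to σ b))
relabel {A = A} σ cr = record
  { notColourable     = λ c c-proper → notColourable cr (c ∘ from) λ u v e →
                          c-proper (from u) (from v) (subst₂ (λ s t → A s t ≡ true)
                                                             (sym (strictlyInverseˡ u)) (sym (strictlyInverseˡ v)) e)
  ; colourableWithout = λ u v e → let c , c-except = colourableWithout cr (to u) (to v) e in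
                          c ∘ to , λ a b e′ eq → sameEdge-injective to-injective (c-except (to a) (to b) e′ eq)
  ; neighbour         = λ w → let v , e = neighbour cr (to w) in
                          from v , subst (λ t → A (to w) t ≡ true) (sym (strictlyInverseˡ v)) e
  }
  where
  open Inverse σ
  to-injective : ∀ {a b} → to a ≡ to b → a ≡ b
  to-injective {a} {b} eq = trans (sym (strictlyInverseʳ a)) (trans (cong from eq) (strictlyInverseʳ b))

adjacent-deleteEdge⁻ : ∀ {n} {G : Graph n} {u v a b} →
                       Adjacent (deleteEdge G u v) a b → Adjacent G a b × ¬ SameEdge u v a b
adjacent-deleteEdge⁻ {G = G} {u} {v} {a} {b} = split (adj G a b) (sameEdge? u v a b)
  where
  split : ∀ x (same? : Dec (SameEdge u v a b)) → x ∧ not (does same?) ≡ true → x ≡ true × ¬ SameEdge u v a b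
  split true (no ¬same) _ = refl , ¬same

adjacent-deleteEdge⁺ : ∀ {n} {G : Graph n} {u v a b} →
                       Adjacent G a b → ¬ SameEdge u v a b → Adjacent (deleteEdge G u v) a b
adjacent-deleteEdge⁺ {G = G} {u} {v} {a} {b} e ¬same = join (adj G a b) (sameEdge? u v a b) e
  where
  join : ∀ x (same? : Dec (SameEdge u v a b)) → x ≡ true → x ∧ not (does same?) ≡ true
  join true (no _)     _ = refl
  join _    (yes same) _ = ⊥-elim (¬same same)

module _ {n m} {G : Graph n} {c : Fin n → Fin m} {u v : Fin n} where

  isProperExcept⇒isProper-deleteEdge : IsProperExcept (adj G) c u v → IsProper (adj (deleteEdge G u v)) c
  isProperExcept⇒isProper-deleteEdge c-except a b e ca≡cb =
    let e′ , ¬same = adjacent-deleteEdge⁻ {G = G} e in ¬same (c-except a b e′ ca≡cb)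

  isProper-deleteEdge⇒isProperExcept : IsProper (adj (deleteEdge G u v)) c → IsProperExcept (adj G) c u v
  isProper-deleteEdge⇒isProperExcept c-proper a b e ca≡cb with sameEdge? u v a b
  ... | yes same = same
  ... | no ¬same = ⊥-elim (c-proper a b (adjacent-deleteEdge⁺ {G = G} e ¬same) ca≡cb)

isProperExcept⇒isProper-deleteVertex : ∀ {n m} {G : Graph (suc n)} {c : Fin (suc n) → Fin m} {v w} →
  IsProperExcept (adj G) c v w → IsProper (adj (deleteVertex G v)) (c ∘ punchIn v)
isProperExcept⇒isProper-deleteVertex {v = v} c-except a b e ca≡cb with c-except (punchIn v a) (punchIn v b) e ca≡cb
... | inj₁ (a≡v , _) = punchInᵢ≢i v a a≡v
... | inj₂ (_ , b≡v) = punchInᵢ≢i v b b≡v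

isolate : ∀ {p m} → Fin p → (Fin p → Fin m) → Fin p → Fin (suc m)
isolate v c u with u ≟ v
... | yes _ = fromℕ _
... | no  _ = inject₁ (c u)

isolate-isProper : ∀ {p m} {G : Graph p} {c : Fin p → Fin m} {v w} →
                   IsProperExcept (adj G) c v w → IsProper (adj G) (isolate v c)
isolate-isProper {G = G} {c} {v} c-except a b e eq with a ≟ v | b ≟ v
... | yes refl | yes refl = contradiction (trans (sym e) (irrefl G a)) λ ()
... | yes _    | no  _    = fromℕ≢inject₁ eq
... | no  _    | yes _    = fromℕ≢inject₁ (sym eq)
... | no  a≢v  | no  b≢v  with c-except a b e (inject₁-injective eq)
...   | inj₁ (a≡v , _) = a≢v a≡v
...   | inj₂ (_ , b≡v) = b≢v b≡v

isolate-unique : ∀ {p m} (v : Fin p) (c : Fin p → Fin m) u → isolate v c u ≡ isolate v c v → u ≡ v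
isolate-unique v c u eq with u ≟ v | v ≟ v
... | yes u≡v | _       = u≡v
... | no  _   | yes _   = ⊥-elim (fromℕ≢inject₁ (sym eq))
... | no  _   | no  v≢v = ⊥-elim (v≢v refl)

colourUniquely : ∀ {p m} {G : Graph p} → EdgeCritical m (adj G) →
                 ∀ v → Σ (Fin p → Fin (suc m)) λ c → IsProper (adj G) c × (∀ u → c u ≡ c v → u ≡ v)
colourUniquely {G = G} cr v =
  let w , vw       = neighbour cr v
      c , c-except = colourableWithout cr v w vw
  in isolate v c , isolate-isProper {G = G} c-except , isolate-unique v c

module _ {n} {G : Graph n} where

  colourable-≤ : ∀ {j m} → j ≤ m → Colourable G j → Colourable G m
  colourable-≤ j≤m (c , c-proper) =
    (λ u → inject≤ (c u) j≤m) , λ a b e eq → c-proper a b e (inject≤-injective j≤m j≤m (c a) (c b) eq)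

  ¬colourable⇒< : ∀ {m} → ¬ Colourable G m → ∀ {j} → Colourable G j → m < j
  ¬colourable⇒< {m} ¬col {j} col with j ≤? m
  ... | yes j≤m = ⊥-elim (¬col (colourable-≤ j≤m col))
  ... | no  j≰m = ≰⇒> j≰m

  chromaticNumber-≤ : ∀ {j m} → ChromaticNumber G j → Colourable G m → j ≤ m
  chromaticNumber-≤ {j} {m} (_ , minimal) col with m <? j
  ... | yes m<j = ⊥-elim (minimal m m<j col)
  ... | no  m≮j = ≮⇒≥ m≮j

module _ {n m} {G : Graph (suc n)} (cr : EdgeCritical m (adj G)) where

  private
    m<colours : ∀ {j} → Colourable G j → m < j
    m<colours = ¬colourable⇒< {G = G} λ (c , c-proper) → notColourable cr c c-proper

    colourable-deleteVertex : ∀ v → Colourable (deleteVertex G v) m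
    colourable-deleteVertex v =
      let w , vw       = neighbour cr v
          c , c-except = colourableWithout cr v w vw
      in c ∘ punchIn v , isProperExcept⇒isProper-deleteVertex {G = G} c-except

    colourable-deleteEdge : ∀ u v → Adjacent G u v → Colourable (deleteEdge G u v) m
    colourable-deleteEdge u v e =
      let c , c-except = colourableWithout cr u v e
      in c , isProperExcept⇒isProper-deleteEdge {G = G} c-except

  edgeCritical⇒KCritical : KCritical (suc m) G
  edgeCritical⇒KCritical =
      ( (let c , c-proper , _ = colourUniquely {G = G} cr zero in c , c-proper)
      , λ j j<1+m col → ≤⇒≯ (s≤s⁻¹ j<1+m) (m<colours col) )
    , (λ v a b χa χb → ≤-<-trans (chromaticNumber-≤ {G = deleteVertex G v} χb (colourable-deleteVertex v))
                                  (m<colours (proj₁ χa)))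
    , (λ u v e a b χa χb → ≤-<-trans (chromaticNumber-≤ {G = deleteEdge G u v} χb (colourable-deleteEdge u v e))
                                      (m<colours (proj₁ χa)))

distinct : ∀ {n} → Fin n → Fin n → Bool
distinct i j = not (does (i ≟ j))

distinct-sym : ∀ {n} (i j : Fin n) → distinct i j ≡ distinct j i
distinct-sym i j with i ≟ j | j ≟ i
... | yes _   | yes _   = refl
... | no  _   | no  _   = refl
... | yes i≡j | no  j≢i = ⊥-elim (j≢i (sym i≡j))
... | no  i≢j | yes j≡i = ⊥-elim (i≢j (sym j≡i))

distinct-irrefl : ∀ {n} (i : Fin n) → distinct i i ≡ false
distinct-irrefl i = cong not (dec-true (i ≟ i) refl)

distinct⇒≢ : ∀ {n} {i j : Fin n} → distinct i j ≡ true → i ≢ j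
distinct⇒≢ {i = i} e refl = contradiction (trans (sym e) (distinct-irrefl i)) λ ()

≢⇒distinct : ∀ {n} {i j : Fin n} → i ≢ j → distinct i j ≡ true
≢⇒distinct {i = i} {j} i≢j = cong not (dec-false (i ≟ j) i≢j)

≟-true⇒≡ : ∀ {n} {a b : Fin n} → does (a ≟ b) ≡ true → a ≡ b
≟-true⇒≡ {a = a} {b} e with a ≟ b | e
... | yes a≡b | _ = a≡b
... | no  _   | ()

transpose-injective : ∀ {n} (i j : Fin n) {a b} → transpose i j a ≡ transpose i j b → a ≡ b
transpose-injective i j {a} {b} eq =
  trans (sym (transpose-inverse j i)) (trans (cong (transpose j i) eq) (transpose-inverse j i))

transpose-matchˡ : ∀ {n} (i j : Fin n) → transpose i j i ≡ j
transpose-matchˡ i j rewrite dec-true (i ≟ i) refl = refl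

merge : ∀ {n} (i j : Fin (suc n)) → i ≢ j → Fin (suc n) → Fin n
merge i j i≢j t with t ≟ j
... | yes _   = punchOut (i≢j ∘ sym)
... | no  t≢j = punchOut (t≢j ∘ sym)

merge-isProperExcept : ∀ {n} (i j : Fin (suc n)) (i≢j : i ≢ j) → IsProperExcept distinct (merge i j i≢j) i j
merge-isProperExcept i j i≢j s t s≢t eq with s ≟ j | t ≟ j
... | yes s≡j | yes t≡j = ⊥-elim (distinct⇒≢ {i = s} s≢t (trans s≡j (sym t≡j)))
... | yes s≡j | no  t≢j = inj₂ (s≡j , sym (punchOut-injective (i≢j ∘ sym) (t≢j ∘ sym) eq))
... | no  s≢j | yes t≡j = inj₁ (punchOut-injective (s≢j ∘ sym) (i≢j ∘ sym) eq , t≡j)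
... | no  s≢j | no  t≢j = ⊥-elim (distinct⇒≢ {i = s} s≢t (punchOut-injective (s≢j ∘ sym) (t≢j ∘ sym) eq))

complete : ∀ n → Graph n
complete n = record { adj = distinct ; sym = distinct-sym ; irrefl = distinct-irrefl }

complete-edgeCritical : ∀ {m} → EdgeCritical (suc m) (adj (complete (2 + m)))
complete-edgeCritical = record
  { notColourable     = λ c c-proper → let i , j , i<j , ci≡cj = pigeonhole ≤-refl c in
                          c-proper i j (≢⇒distinct (<⇒≢ i<j)) ci≡cj
  ; colourableWithout = λ i j e → merge i j (distinct⇒≢ e) , merge-isProperExcept i j (distinct⇒≢ e)
  ; neighbour         = λ v → punchIn v zero , ≢⇒distinct (punchInᵢ≢i v zero ∘ sym)
  }

-- Clique extensions: cones and Hajós joins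

cliqueRel : ∀ {V : Set} {k} → (V → V → Bool) → (Fin k → V → Bool) → Fin k ⊎ V → Fin k ⊎ V → Bool
cliqueRel A N (inj₁ i) (inj₁ j) = distinct i j
cliqueRel A N (inj₁ i) (inj₂ v) = N i v
cliqueRel A N (inj₂ v) (inj₁ i) = N i v
cliqueRel A N (inj₂ u) (inj₂ v) = A u v

cliqueRel-isProperExcept :
  ∀ {V : Set} {k m} {A : V → V → Bool} {N : Fin k → V → Bool} {κ : Fin k → Fin m} {ψ : V → Fin m} {s t} →
  (∀ i j → i ≢ j → κ i ≡ κ j → SameEdge s t (inj₁ i) (inj₁ j)) →
  (∀ i v → N i v ≡ true → κ i ≡ ψ v → SameEdge s t (inj₁ i) (inj₂ v)) →
  (∀ u v → A u v ≡ true → ψ u ≡ ψ v → SameEdge s t (inj₂ u) (inj₂ v)) →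
  IsProperExcept (cliqueRel A N) [ κ , ψ ] s t
cliqueRel-isProperExcept new-new new-old old-old (inj₁ i) (inj₁ j) e    = new-new i j (distinct⇒≢ e)
cliqueRel-isProperExcept new-new new-old old-old (inj₁ i) (inj₂ v) e    = new-old i v e
cliqueRel-isProperExcept new-new new-old old-old (inj₂ v) (inj₁ i) e eq = sameEdge-flip (new-old i v e (sym eq))
cliqueRel-isProperExcept new-new new-old old-old (inj₂ u) (inj₂ v) e    = old-old u v e

cliqueRel-map₁-suc : ∀ {V : Set} {k} (A : V → V → Bool) (N : Fin (suc k) → V → Bool) s t →
                     cliqueRel A N (map₁ suc s) (map₁ suc t) ≡ cliqueRel A (N ∘ suc) s t
cliqueRel-map₁-suc A N (inj₁ i) (inj₁ j) = refl
cliqueRel-map₁-suc A N (inj₁ i) (inj₂ v) = refl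
cliqueRel-map₁-suc A N (inj₂ v) (inj₁ i) = refl
cliqueRel-map₁-suc A N (inj₂ u) (inj₂ v) = refl

-- The k new vertices, pairwise adjacent, come first (as in splitAt k); new vertex i is also
-- adjacent to the old vertices in N i.
cliqueExtension : ∀ {p} k → Graph p → (Fin k → Fin p → Bool) → Graph (k + p)
cliqueExtension k H N = record
  { adj    = λ a b → cliqueRel (adj H) N (splitAt k a) (splitAt k b)
  ; sym    = λ a b → rel-sym (splitAt k a) (splitAt k b)
  ; irrefl = λ a → rel-irrefl (splitAt k a)
  }
  where
  rel-sym : ∀ s t → cliqueRel (adj H) N s t ≡ cliqueRel (adj H) N t s
  rel-sym (inj₁ i) (inj₁ j) = distinct-sym i j
  rel-sym (inj₁ i) (inj₂ v) = refl
  rel-sym (inj₂ v) (inj₁ i) = refl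
  rel-sym (inj₂ u) (inj₂ v) = Graph.sym H u v
  rel-irrefl : ∀ s → cliqueRel (adj H) N s s ≡ false
  rel-irrefl (inj₁ i) = distinct-irrefl i
  rel-irrefl (inj₂ v) = irrefl H v

cliqueExtension-edgeCritical : ∀ {p k m} {H : Graph p} {N : Fin k → Fin p → Bool} →
  EdgeCritical m (cliqueRel (adj H) N) → EdgeCritical m (adj (cliqueExtension k H N))
cliqueExtension-edgeCritical = relabel +↔⊎

[1+n]C2≡n+nC2 : ∀ n → suc n C 2 ≡ n + n C 2
[1+n]C2≡n+nC2 n = trans (sym (nCk+nC[k+1]≡[n+1]C[k+1] n 1)) (cong (_+ n C 2) (nC1≡n n))

cliqueExtension-edgeCount : ∀ {p} k (H : Graph p) (N : Fin k → Fin p → Bool) {d} → (∀ i → count (N i) ≤ d) →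
                            edgeCount (cliqueExtension k H N) ≤ k C 2 + k * d + edgeCount H
cliqueExtension-edgeCount zero    H N N≤d = ≤-refl
cliqueExtension-edgeCount (suc k) H N {d} N≤d = begin
  edgeCount G
    ≡⟨ edgeCount-suc G ⟩
  count (adj G zero ∘ suc) + edgeCount (deleteVertex G zero)
    ≤⟨ +-mono-≤ apex-degree (edgeCount-mono {G = deleteVertex G zero} {cliqueExtension k H (N ∘ suc)} λ a b e →
                               trans (sym (cliqueRel-map₁-suc (adj H) N (splitAt k a) (splitAt k b))) e) ⟩
  (k + d) + edgeCount (cliqueExtension k H (N ∘ suc))
    ≤⟨ +-monoʳ-≤ (k + d) (cliqueExtension-edgeCount k H (N ∘ suc) (N≤d ∘ suc)) ⟩
  (k + d) + (k C 2 + k * d + edgeCount H)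
    ≡⟨ rearrange k d (k C 2) (edgeCount H) ⟩
  (k + k C 2) + (d + k * d) + edgeCount H
    ≡⟨ cong (λ c → c + suc k * d + edgeCount H) (sym ([1+n]C2≡n+nC2 k)) ⟩
  suc k C 2 + suc k * d + edgeCount H ∎
  where
  open ≤-Reasoning
  G = cliqueExtension (suc k) H N
  apex-degree : count (adj G zero ∘ suc) ≤ k + d
  apex-degree = begin
    count (adj G zero ∘ suc)
      ≡⟨ count-splitAt k (cliqueRel (adj H) N (inj₁ zero) ∘ map₁ suc) ⟩
    count {k} (λ _ → true) + count (N zero)
      ≡⟨ cong (_+ count (N zero)) (count-true k) ⟩
    k + count (N zero)
      ≤⟨ +-monoʳ-≤ k (N≤d zero) ⟩
    k + d ∎
  rearrange : ∀ k d c e → (k + d) + (c + k * d + e) ≡ (k + c) + (d + k * d) + e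
  rearrange = solve 4 (λ k d c e → (k :+ d) :+ (c :+ k :* d :+ e) := (k :+ c) :+ (d :+ k :* d) :+ e) refl
    where open +-*-Solver

cone : ∀ {p} → Graph p → Graph (suc p)
cone H = cliqueExtension 1 H λ _ _ → true

module _ {p m} {H : Graph p} (v₀ : Fin p) (cr : EdgeCritical (suc m) (adj H)) where

  private
    R = cliqueRel {k = 1} (adj H) λ _ _ → true
    Colouring = Fin 1 ⊎ Fin p → Fin (2 + m)

    apexEdge : ∀ a → Σ Colouring λ c → IsProperExcept R c (inj₁ zero) (inj₂ a)
    apexEdge a with colourUniquely {G = H} cr a
    ... | c , c-proper , c-unique = [ (λ _ → c a) , c ] , cliqueRel-isProperExcept
      (λ { zero zero 0≢0 _ → ⊥-elim (0≢0 refl) })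
      (λ { zero v _ ca≡cv → inj₁ (refl , cong inj₂ (c-unique v (sym ca≡cv))) })
      (λ u v e cu≡cv → ⊥-elim (c-proper u v e cu≡cv))

    innerEdge : ∀ a b → Adjacent H a b → Σ Colouring λ c → IsProperExcept R c (inj₂ a) (inj₂ b)
    innerEdge a b e with colourableWithout cr a b e
    ... | c , c-except = [ (λ _ → fromℕ (suc m)) , inject₁ ∘ c ] , cliqueRel-isProperExcept
      (λ { zero zero 0≢0 _ → ⊥-elim (0≢0 refl) })
      (λ _ _ _ eq → ⊥-elim (fromℕ≢inject₁ eq))
      (λ u v e′ eq → sameEdge-map inj₂ (c-except u v e′ (inject₁-injective eq)))

    coneRel-edgeCritical : EdgeCritical (2 + m) R
    notColourable coneRel-edgeCritical φ φ-proper = notColourable cr ψ ψ-proper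
      where
      apex≢ : ∀ a → φ (inj₁ zero) ≢ φ (inj₂ a)
      apex≢ a = φ-proper (inj₁ zero) (inj₂ a) refl
      ψ : Fin p → Fin (suc m)
      ψ a = punchOut (apex≢ a)
      ψ-proper : IsProper (adj H) ψ
      ψ-proper a b e eq = φ-proper (inj₂ a) (inj₂ b) e (punchOut-injective (apex≢ a) (apex≢ b) eq)
    colourableWithout coneRel-edgeCritical (inj₁ zero) (inj₁ zero) ()
    colourableWithout coneRel-edgeCritical (inj₁ zero) (inj₂ a)    _ = apexEdge a
    colourableWithout coneRel-edgeCritical (inj₂ a)    (inj₁ zero) _ = Product.map₂ isProperExcept-swap (apexEdge a)
    colourableWithout coneRel-edgeCritical (inj₂ a)    (inj₂ b)    e = innerEdge a b e
    neighbour coneRel-edgeCritical (inj₁ zero) = inj₂ v₀ , refl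
    neighbour coneRel-edgeCritical (inj₂ a)    = inj₁ zero , refl

  cone-edgeCritical : EdgeCritical (2 + m) (adj (cone H))
  cone-edgeCritical = cliqueExtension-edgeCritical {H = H} coneRel-edgeCritical

anchor : ∀ {p k} → Fin p → Fin p → Fin (suc k) → Fin p
anchor x y zero    = y
anchor x y (suc _) = x

-- The Hajós join of H and the complete graph on x, b, c₁, …, c_{m+1} along the edges xy and xb:
-- both edges are deleted and the edge by is added. New vertex zero is b, with anchor y, and
-- suc i is c_{i+1}, with anchor x.
hajós : ∀ {p} m → Graph p → Fin p → Fin p → Graph (2 + m + p)
hajós m H x y = cliqueExtension (2 + m) (deleteEdge H x y) λ i v → does (v ≟ anchor x y i)

module _ {p m} {H : Graph p} (cr : EdgeCritical (2 + m) (adj H)) {x y : Fin p} (xy : Adjacent H x y) where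

  private
    N : Fin (2 + m) → Fin p → Bool
    N i v = does (v ≟ anchor x y i)
    H′ = deleteEdge H x y
    R = cliqueRel (adj H′) N
    Colouring = Fin (2 + m) ⊎ Fin p → Fin (2 + m)

    ψ₀ = proj₁ (colourableWithout cr x y xy)
    ψ₀-proper : IsProper (adj H′) ψ₀
    ψ₀-proper = isProperExcept⇒isProper-deleteEdge {G = H} (proj₂ (colourableWithout cr x y xy))
    ψ₀-anchor : ∀ (i : Fin (2 + m)) → ψ₀ (anchor x y i) ≡ ψ₀ x
    ψ₀-anchor zero    = sym (isProperExcept⇒≡ cr (proj₂ (colourableWithout cr x y xy)))
    ψ₀-anchor (suc _) = refl

    newOld : ∀ i v → N i v ≡ true → Σ Colouring λ c → IsProperExcept R c (inj₁ i) (inj₂ v)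
    newOld i v e with refl ← ≟-true⇒≡ {a = v} e = [ transpose i (ψ₀ x) , ψ₀ ] , cliqueRel-isProperExcept
      (λ j k j≢k eq → ⊥-elim (j≢k (transpose-injective i (ψ₀ x) eq)))
      new-old
      (λ u w e′ eq → ⊥-elim (ψ₀-proper u w e′ eq))
      where
      new-old : ∀ j w → N j w ≡ true → transpose i (ψ₀ x) j ≡ ψ₀ w →
                SameEdge (inj₁ i) (inj₂ (anchor x y i)) (inj₁ j) (inj₂ w)
      new-old j w e′ eq
        with refl ← ≟-true⇒≡ {a = w} e′
        with refl ← transpose-injective i (ψ₀ x) {j} {i}
                      (trans eq (trans (ψ₀-anchor j) (sym (transpose-matchˡ i (ψ₀ x)))))
        = inj₁ (refl , refl)

    newNew : ∀ i j → i ≢ j → Σ Colouring λ c → IsProperExcept R c (inj₁ i) (inj₁ j)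
    newNew i j i≢j = [ punchIn (ψ₀ x) ∘ merge i j i≢j , ψ₀ ] , cliqueRel-isProperExcept
      (λ s t s≢t eq → sameEdge-map inj₁
         (merge-isProperExcept i j i≢j s t (≢⇒distinct s≢t) (punchIn-injective (ψ₀ x) _ _ eq)))
      (λ s w e′ eq → ⊥-elim (punchInᵢ≢i (ψ₀ x) (merge i j i≢j s)
                              (trans eq (trans (cong ψ₀ (≟-true⇒≡ {a = w} e′)) (ψ₀-anchor s)))))
      (λ u w e′ eq → ⊥-elim (ψ₀-proper u w e′ eq))

    oldOld : ∀ u v → Adjacent H′ u v → Σ Colouring λ c → IsProperExcept R c (inj₂ u) (inj₂ v)
    oldOld u v e with adjacent-deleteEdge⁻ {G = H} e
    ... | uv , ¬xy with colourableWithout cr u v uv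
    ... | ψ , ψ-except = [ transpose zero (ψ x) , ψ ] , cliqueRel-isProperExcept
      (λ j k j≢k eq → ⊥-elim (j≢k (transpose-injective zero (ψ x) eq)))
      (λ j w e′ eq → ⊥-elim (new-old j (trans eq (cong ψ (≟-true⇒≡ {a = w} e′)))))
      (λ a b e′ eq → sameEdge-map inj₂ (ψ-except a b (proj₁ (adjacent-deleteEdge⁻ {G = H} e′)) eq))
      where
      ψx≢ψy : ψ x ≢ ψ y
      ψx≢ψy eq = ¬xy (sameEdge-comm (ψ-except x y xy eq))
      new-old : ∀ j → transpose zero (ψ x) j ≢ ψ (anchor x y j)
      new-old zero    eq = ψx≢ψy (trans (sym (transpose-matchˡ zero (ψ x))) eq)
      new-old (suc j) eq = case transpose-injective zero (ψ x) {suc j} {zero}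
                                  (trans eq (sym (transpose-matchˡ zero (ψ x)))) of λ ()

    hajósRel-edgeCritical : EdgeCritical (2 + m) R
    notColourable hajósRel-edgeCritical φ φ-proper =
      φ-proper (inj₁ zero) (inj₂ y) (dec-true (y ≟ y) refl) (trans b≡x x≡y)
      where
      -- x and the new vertices are 3 + m vertices in 2 + m colours, and x is adjacent to all
      -- of them but b.
      f : Fin (3 + m) → Fin (2 + m)
      f zero    = φ (inj₂ x)
      f (suc i) = φ (inj₁ i)
      pigeon : ∀ i j → toℕ i < toℕ j → f i ≡ f j → φ (inj₁ zero) ≡ φ (inj₂ x)
      pigeon zero    (suc zero)    _   eq = sym eq
      pigeon zero    (suc (suc l)) _   eq = ⊥-elim (φ-proper (inj₂ x) (inj₁ (suc l)) (dec-true (x ≟ x) refl) eq)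
      pigeon (suc i) (suc j)       i<j eq =
        ⊥-elim (φ-proper (inj₁ i) (inj₁ j) (≢⇒distinct (<⇒≢ i<j ∘ cong suc)) eq)
      b≡x : φ (inj₁ zero) ≡ φ (inj₂ x)
      b≡x = let i , j , i<j , fi≡fj = pigeonhole ≤-refl f in pigeon i j i<j fi≡fj
      x≡y : φ (inj₂ x) ≡ φ (inj₂ y)
      x≡y = isProperExcept⇒≡ cr
              (isProper-deleteEdge⇒isProperExcept {G = H} λ a b e → φ-proper (inj₂ a) (inj₂ b) e)
    colourableWithout hajósRel-edgeCritical (inj₁ i) (inj₁ j) e = newNew i j (distinct⇒≢ e)
    colourableWithout hajósRel-edgeCritical (inj₁ i) (inj₂ v) e = newOld i v e
    colourableWithout hajósRel-edgeCritical (inj₂ v) (inj₁ i) e = Product.map₂ isProperExcept-swap (newOld i v e)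
    colourableWithout hajósRel-edgeCritical (inj₂ u) (inj₂ v) e = oldOld u v e
    neighbour hajósRel-edgeCritical (inj₁ i) = inj₂ (anchor x y i) , dec-true (anchor x y i ≟ anchor x y i) refl
    neighbour hajósRel-edgeCritical (inj₂ v) with v ≟ x | v ≟ y
    ... | yes refl | _        = inj₁ (suc zero) , dec-true (v ≟ v) refl
    ... | no  _    | yes refl = inj₁ zero , dec-true (v ≟ v) refl
    ... | no  v≢x  | no  v≢y  with neighbour cr v
    ...   | w , vw = inj₂ w , adjacent-deleteEdge⁺ {G = H} vw λ where
      (inj₁ (v≡x , _)) → v≢x v≡x
      (inj₂ (v≡y , _)) → v≢y v≡y

  hajós-edgeCritical : EdgeCritical (2 + m) (adj (hajós m H x y))
  hajós-edgeCritical = cliqueExtension-edgeCritical {H = H′} hajósRel-edgeCritical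

-- Sparse critical graphs

record SparseCritical (m c n : ℕ) : Set where
  constructor sparseCritical
  field
    graph        : Graph n
    edgeCritical : EdgeCritical m (adj graph)
    sparse       : edgeCount graph ≤ c * n

cone-sparse : ∀ {m c n} → SparseCritical (suc m) c n → Fin n → SparseCritical (2 + m) (suc c) (suc n)
cone-sparse {m} {c} {n} (sparseCritical H cr sparse) v =
  sparseCritical (cone H) (cone-edgeCritical {H = H} v cr) (begin
    edgeCount (cone H)    ≤⟨ cliqueExtension-edgeCount 1 H (λ _ _ → true) (λ _ → count≤n _) ⟩
    1 * n + edgeCount H   ≤⟨ +-mono-≤ (≤-reflexive (*-identityˡ n)) sparse ⟩
    n + c * n             ≤⟨ *-monoʳ-≤ (suc c) (n≤1+n n) ⟩
    suc c * suc n         ∎)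
  where open ≤-Reasoning

hajós-sparse : ∀ {m c p} → SparseCritical (2 + m) c (suc p) → (2 + m) C 2 + (2 + m) ≤ c * (2 + m) →
               SparseCritical (2 + m) c (2 + m + suc p)
hajós-sparse {m} {c} {p} (sparseCritical H cr sparse) newEdges≤ with neighbour cr zero
... | y , xy = sparseCritical (hajós m H zero y) (hajós-edgeCritical {H = H} cr xy) (begin
  edgeCount (hajós m H zero y)
    ≤⟨ cliqueExtension-edgeCount (2 + m) (deleteEdge H zero y) _
         (λ i → ≤-reflexive (count-≟ (anchor zero y i))) ⟩
  (2 + m) C 2 + (2 + m) * 1 + edgeCount (deleteEdge H zero y)
    ≤⟨ +-mono-≤ (≤-reflexive (cong ((2 + m) C 2 +_) (*-identityʳ (2 + m))))
                (edgeCount-mono {G = deleteEdge H zero y} {H} λ a b e → proj₁ (adjacent-deleteEdge⁻ {G = H} e)) ⟩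
  (2 + m) C 2 + (2 + m) + edgeCount H
    ≤⟨ +-mono-≤ newEdges≤ sparse ⟩
  c * (2 + m) + c * suc p
    ≡⟨ sym (*-distribˡ-+ c (2 + m) (suc p)) ⟩
  c * (2 + m + suc p) ∎)
  where open ≤-Reasoning

triangle : SparseCritical 2 1 3
triangle = sparseCritical (complete 3) complete-edgeCritical (toWitness {a? = edgeCount (complete 3) ≤? 3} _)

pentagon : SparseCritical 2 1 5
pentagon = sparseCritical C₅ (hajós-edgeCritical {H = complete 3} complete-edgeCritical refl)
                          (toWitness {a? = edgeCount C₅ ≤? 5} _)
  where C₅ = hajós 0 (complete 3) zero (suc zero)

heptagon : SparseCritical 2 1 7
heptagon = sparseCritical C₇ (hajós-edgeCritical {H = graph} edgeCritical refl)
                          (toWitness {a? = edgeCount C₇ ≤? 7} _)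
  where
  open SparseCritical pentagon
  C₇ = hajós 0 graph zero (suc zero)

fourCritical : ∀ d → SparseCritical 3 2 (7 + d)
fourCritical 0                   = hajós-sparse (cone-sparse triangle zero) ≤-refl
fourCritical 1                   = cone-sparse heptagon zero
fourCritical 2                   = hajós-sparse (cone-sparse pentagon zero) ≤-refl
fourCritical (suc (suc (suc d))) = hajós-sparse (fourCritical d) ≤-refl

cones : ∀ i {n} → SparseCritical 3 2 n → Fin n → SparseCritical (3 + i) (2 + i) (i + n)
cones zero    S v = S
cones (suc i) S v = cone-sparse (cones i S v) (i ↑ʳ v)

lemma2p2 : (k : ℕ) → 4 ≤ k → (n : ℕ) → k + 3 ≤ n →
    Σ (Graph n) (λ G → KCritical k G × edgeCount G ≤ (k ∸ 2) * n)
lemma2p2 k 4≤k n k+3≤n with m≤n⇒∃[o]m+o≡n 4≤k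
... | i , refl with m≤n⇒∃[o]m+o≡n k+3≤n
... | d , refl =
  let sparseCritical G cr sparse =
        subst (SparseCritical (3 + i) (2 + i)) (vertexCount i d) (cones i (fourCritical d) zero)
  in G , edgeCritical⇒KCritical {G = G} cr , sparse
  where
  vertexCount : ∀ i d → i + (7 + d) ≡ 4 + i + 3 + d
  vertexCount = solve 2 (λ i d → i :+ (con 7 :+ d) := con 4 :+ i :+ con 3 :+ d) refl
    where open +-*-Solver
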